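{- Let $\mathsf{M}^*$ be an implicit knowledge-based HMS model and $FH^*(\mathsf{M}^*)$ its FH$^*$ transform. For all $\varphi \in \mathcal{L}_{\mathsf{At}}$ and all $\omega \in S_{\mathsf{At}}$: $\mathsf{M}^*, \omega \vDash \varphi$ if and only if $FH^*(\mathsf{M}^*), \omega \Vdash \varphi$.
   Context: Fix nonempty sets $\mathsf{At}$ (atoms) and $I$ (agents). Lattice: nonempty pairwise disjoint $S_\Phi$ ($\Phi\subseteq\mathsf{At}$), $S_\Psi\preceq S_\Phi$ iff $\Psi\subseteq\Phi$, $\Omega := \bigcup_\Phi S_\Phi$, surjections $r^\Phi_\Psi:S_\Phi\to S_\Psi$ ($\Psi\subseteq\Phi$) with $r^\Phi_\Phi$ identity and $r^\Phi_\Upsilon=r^\Psi_\Upsilon\circ r^\Phi_\Psi$; $\omega_\Psi := r^\Phi_\Psi(\omega)$; $D_\Psi := r^\Phi_\Psi(D)$, $D_S := D_\Psi$ for $S=S_\Psi$; $S_\omega$ the space containing $\omega$; $D^\uparrow := \bigcup_{\Phi\subseteq\Psi}(r^\Psi_\Phi)^{ -1}(D)$ for $D\subseteq S_\Phi$. Events: sets $E=D^\uparrow$ with base-space $S(E):=S_\Phi$ (distinct vacuous events $\emptyset^{S_\Phi}$ for each $\Phi$); $\neg E := (S_\Phi\setminus D)^\uparrow$. An implicit knowledge-based HMS model $\mathsf{M}^* = \langle I, \{S_\Phi\}, (r^\Phi_\Psi), (\Lambda_i), (\alpha_i), v\rangle$: valuation $v$ from atoms to events; $\Lambda_i:\Omega\to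 2^\Omega\setminus\{\emptyset\}$ with Reflexivity, Stationarity ($\omega'\in\Lambda_i(\omega)\Rightarrow\Lambda_i(\omega')=\Lambda_i(\omega)$), Projections Preserve Implicit Knowledge ($\omega\in S_\Phi\Rightarrow\Lambda_i(\omega)_\Psi=\Lambda_i(\omega_\Psi)$ for $\Psi\subseteq\Phi$); $\alpha_i:\Omega\to\{S_\Phi\}$ with: O. $\omega\in S_\Phi\Rightarrow\alpha_i(\omega)\preceq S_\Phi$; I. $\omega'\in\Lambda_i(\omega)\Rightarrow\alpha_i(\omega')=\alpha_i(\omega)$; II. $\omega\in S_\Phi$, $S_\Psi\preceq\alpha_i(\omega)\Rightarrow\alpha_i(\omega_\Psi)=S_\Psi$; III. $\omega\in S_\Phi$, $\alpha_i(\omega)\preceq S_\Psi\preceq S_\Phi\Rightarrow\alpha_i(\omega_\Psi)=\alpha_i(\omega)$; IV. $\omega\in S_\Phi$, $\Psi\subseteq\Phi\Rightarrow\alpha_i(\omega)\succeq\alpha_i(\omega_\Psi)$. Derived explicit correspondence: $\Pi^*_i(\omega_\Phi) := \Lambda_i(\omega)_{\alpha_i(\omega_\Phi)}$ for $\omega\in\Omega$, $S_\Phi\preceq S_\omega$. Language: $\varphi ::= \top\mid p\mid\neg\varphi\mid\varphi\wedge\psi\mid\ell_i\varphi\mid a_i\varphi\mid k_i\varphi$; $\mathsf{At}(\varphi)$ atoms; $\mathcal{L}_\Phi := \{\varphi:\mathsf{At}(\varphi)\subseteq\Phi\}$. Satisfaction in $\mathsf{M}^*$ ($[\varphi] :=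 \{\omega:\mathsf{M}^*,\omega\vDash\varphi\}$): $\top$ everywhere; $p$ iff $\omega\in v(p)$; $\neg\varphi$ iff $\omega\in\neg[\varphi]$; $\varphi\wedge\psi$ iff $\omega\in[\varphi]\cap[\psi]$; $a_i\varphi$ iff $\alpha_i(\omega)\succeq S([\varphi])$; $\ell_i\varphi$ iff $\Lambda_i(\omega)\subseteq[\varphi]$; $k_i\varphi$ iff $\Pi^*_i(\omega)\subseteq[\varphi]$. FH$^*$ transform $FH^*(\mathsf{M}^*) = \langle I, W_{\mathsf{At}}, (R_{\mathsf{At},i}), (\mathcal{A}_{\mathsf{At},i}), V_{\mathsf{At}}\rangle$: $W_{\mathsf{At}} := S_{\mathsf{At}}$; $(\omega,\omega')\in R_{\mathsf{At},i}$ iff $\omega'\in\Lambda_i(\omega)$; $\mathcal{A}_{\mathsf{At},i}(\omega) := \mathcal{L}_\Phi$ for the $\Phi$ with $\alpha_i(\omega)=S_\Phi$; $V_{\mathsf{At}}(p) := v(p)\cap S_{\mathsf{At}}$. FH satisfaction: $\top$ always; $p$ iff $w\in V_{\mathsf{At}}(p)$; Boolean standard; $a_i\varphi$ iff $\varphi\in\mathcal{A}_{\mathsf{At},i}(w)$; $\ell_i\varphi$ iff $\varphi$ at all $R_{\mathsf{At},i}$-successors; $k_i\varphi$ iff $\ell_i\varphi$ and $a_i\varphi$. -}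

module Defs where

open import Level using (0ℓ)
open import Data.Product using (Σ; ∃; _×_; _,_; proj₁; proj₂)
open import Data.Unit using (⊤)
open import Relation.Nullary using (¬_)
open import Relation.Unary using (Pred; _⊆_; _∪_; _∩_; _≐_; _∈_; ∁; ∅; U; ｛_｝)
open import Relation.Binary.PropositionalEquality using (_≡_)

module Logic (At : Set) (I : Set) where

  Sub : Set₁
  Sub = Pred At 0ℓ

  data Form : Set where
    ⊤ᶠ   : Form
    atom : At → Form
    ¬ᶠ   : Form → Form
    _∧ᶠ_ : Form → Form → Form
    ℓᶠ   : I → Form → Form
    aᶠ   : I → Form → Form
    kᶠ   : I → Form → Form

  atoms : Form → Sub
  atoms ⊤ᶠ = ∅
  atoms (atom p) = ｛ p ｝
  atoms (¬ᶠ φ) = atoms φ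
  atoms (φ ∧ᶠ ψ) = atoms φ ∪ atoms ψ
  atoms (ℓᶠ i φ) = atoms φ
  atoms (aᶠ i φ) = atoms φ
  atoms (kᶠ i φ) = atoms φ

  L : Sub → Pred Form 0ℓ
  L Φ φ = atoms φ ⊆ Φ

  img : {A B : Set} → (A → B) → Pred A 0ℓ → Pred B 0ℓ
  img f D y = ∃ λ x → D x × f x ≡ y

  record Lattice : Set₁ where
    field
      S        : Sub → Set
      nonempty : ∀ Φ → S Φ
      r        : ∀ {Φ Ψ} → Ψ ⊆ Φ → S Φ → S Ψ
      r-surj   : ∀ {Φ Ψ} (p : Ψ ⊆ Φ) (y : S Ψ) → ∃ λ x → r p x ≡ y
      r-id     : ∀ {Φ} (p : Φ ⊆ Φ) (x : S Φ) → r p x ≡ x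
      r-comp   : ∀ {Φ Ψ Υ} (p : Υ ⊆ Φ) (q : Υ ⊆ Ψ) (s : Ψ ⊆ Φ) (x : S Φ) →
                 r p x ≡ r q (r s x)

    Ω : Set₁
    Ω = Σ Sub S

    _⪯_ : Sub → Sub → Set
    Ψ ⪯ Φ = Ψ ⊆ Φ

    _↑ : {Φ : Sub} → Pred (S Φ) 0ℓ → Pred Ω 0ℓ
    _↑ {Φ} D (Ψ , x) = Σ (Φ ⊆ Ψ) λ p → D (r p x)

    record Event : Set₁ where
      constructor ev
      field
        base : Sub
        D    : Pred (S base) 0ℓ
      set : Pred Ω 0ℓ
      set = D ↑

    open Event public

    ¬E : Event → Event
    ¬E E = ev (base E) (∁ (D E))

  module HMSDef (Lat : Lattice) where
    open Lattice Lat

    record HMS : Set₁ where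
      field
        -- v(p) is the S_{p}-based event (v p)↑
        v     : (p : At) → Pred (S ｛ p ｝) 0ℓ
        Λ     : I → (Φ : Sub) → S Φ → Pred (S Φ) 0ℓ
        Λ-refl : ∀ i Φ (x : S Φ) → Λ i Φ x x
        Λ-stat : ∀ i Φ (x y : S Φ) → Λ i Φ x y → Λ i Φ y ≐ Λ i Φ x
        Λ-proj : ∀ i {Φ Ψ} (p : Ψ ⊆ Φ) (x : S Φ) → img (r p) (Λ i Φ x) ≐ Λ i Ψ (r p x)
        α     : I → (Φ : Sub) → S Φ → Sub
        α-O   : ∀ i Φ (x : S Φ) → α i Φ x ⪯ Φ
        α-I   : ∀ i Φ (x y : S Φ) → Λ i Φ x y → α i Φ y ≐ α i Φ x
        α-II  : ∀ i {Φ Ψ} (p : Ψ ⊆ Φ) (x : S Φ) → Ψ ⪯ α i Φ x → α i Ψ (r p x) ≐ Ψ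
        α-III : ∀ i {Φ Ψ} (p : Ψ ⊆ Φ) (x : S Φ) → α i Φ x ⪯ Ψ → α i Ψ (r p x) ≐ α i Φ x
        α-IV  : ∀ i {Φ Ψ} (p : Ψ ⊆ Φ) (x : S Φ) → α i Ψ (r p x) ⪯ α i Φ x


      _⊨_ : Ω → Form → Set
      ω ⊨ ⊤ᶠ = ⊤
      ω ⊨ atom p = ω ∈ set (ev ｛ p ｝ (v p))
      ω ⊨ ¬ᶠ φ = ω ∈ set (¬E (ev (atoms φ) (λ y → (atoms φ , y) ⊨ φ)))
      ω ⊨ (φ ∧ᶠ ψ) = ω ∈ ((λ ω' → ω' ⊨ φ) ∩ (λ ω' → ω' ⊨ ψ))
      (Φ , x) ⊨ aᶠ i φ = base (ev (atoms φ) (λ y → (atoms φ , y) ⊨ φ)) ⪯ α i Φ x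
      (Φ , x) ⊨ ℓᶠ i φ = ∀ y → Λ i Φ x y → (Φ , y) ⊨ φ
      -- k_i: Π*_i(ω) ⊆ [φ], where Π*_i(ω) = Λ_i(ω)_{α_i(ω)} (clause with ω_Φ = ω)
      (Φ , x) ⊨ kᶠ i φ = ∀ y → Λ i Φ x y → (α i Φ x , r (α-O i Φ x) y) ⊨ φ

  record FHModel : Set₁ where
    field
      W : Set
      R : I → W → W → Set
      A : I → W → Pred Form 0ℓ
      V : At → Pred W 0ℓ

  module FHSem (M : FHModel) where
    open FHModel M
    _⊩_ : W → Form → Set
    w ⊩ ⊤ᶠ = ⊤
    w ⊩ atom p = V p w
    w ⊩ ¬ᶠ φ = ¬ (w ⊩ φ)
    w ⊩ (φ ∧ᶠ ψ) = (w ⊩ φ) × (w ⊩ ψ)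
    w ⊩ aᶠ i φ = φ ∈ A i w
    w ⊩ ℓᶠ i φ = ∀ w' → R i w w' → w' ⊩ φ
    w ⊩ kᶠ i φ = (∀ w' → R i w w' → w' ⊩ φ) × (φ ∈ A i w)

  FH* : (Lat : Lattice) → HMSDef.HMS Lat → FHModel
  FH* Lat M = record
    { W = S U
    ; R = λ i x y → Λ i U x y
    ; A = λ i x → L (α i U x)
    ; V = λ p x → (U , x) ∈ (v p ↑)
    }
    where open Lattice Lat
          open HMSDef.HMS M

-- Satisfaction in an HMS model is invariant under projecting a state to any
-- space that still expresses the formula: for atoms and negations this is the
-- coherence of the projections, for ℓ_i it is "projections preserve implicit
-- knowledge", and for a_i it follows from properties II and IV of α.  Granting
-- this, k_i φ is equivalent to ℓ_i φ ∧ a_i φ in every HMS model, and the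
-- negation of an expressible formula is its classical negation.  On the
-- upmost space S_At these are exactly the clauses of the FH* transform.
module Submission where

open import Defs
open import Level using (0ℓ)
open import Relation.Unary using (Pred; U; ∁; _⊆_; _∩_; _∈_)
open import Data.Product using (_×_; _,_; proj₁; proj₂)
open import Data.Product.Function.NonDependent.Propositional using (_×-⇔_)
open import Data.Sum using (inj₁; inj₂)
open import Data.Unit using (tt)
open import Relation.Nullary using (¬_)
open import Relation.Binary.PropositionalEquality using (refl; sym; subst)
open import Function.Base using (_∘_; case_of_)
open import Function.Bundles using (_⇔_; mk⇔; Equivalence)
open import Function.Construct.Identity using (⇔-id)
open import Function.Construct.Symmetry using (⇔-sym)
open import Function.Construct.Composition using (_⇔-∘_)
open import Function.Related.TypeIsomorphisms using (¬-cong-⇔)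

module ProjectionInvariance (At I : Set) (Lat : Logic.Lattice At I) (M : Logic.HMSDef.HMS At I Lat) where
  open Logic At I
  open Lattice Lat
  open HMSDef Lat
  open HMS M
  open Equivalence using (to; from)

  ↑-r-⇔ : ∀ {Θ Φ Ψ} (D : Pred (S Θ) 0ℓ) (p : Ψ ⊆ Φ) x → Θ ⊆ Ψ →
          (Φ , x) ∈ D ↑ ⇔ (Ψ , r p x) ∈ D ↑
  ↑-r-⇔ D p x Θ⊆Ψ = mk⇔
    (λ (Θ⊆Φ , d) → Θ⊆Ψ , subst D (r-comp Θ⊆Φ Θ⊆Ψ p x) d)
    (λ (Θ⊆Ψ , d) → (λ z → p (Θ⊆Ψ z)) , subst D (sym (r-comp _ Θ⊆Ψ p x)) d)

  -- By II the projection of x to α(x) ∩ Ψ is aware of all of α(x) ∩ Ψ, and by IV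
  -- awareness only grows from there up to Ψ.
  α∩⊆α-r : ∀ i {Φ Ψ} (p : Ψ ⊆ Φ) x → α i Φ x ∩ Ψ ⊆ α i Ψ (r p x)
  α∩⊆α-r i {Φ} p x {a} a∈ =
    α-IV i proj₂ (r p x)
      (subst (λ y → a ∈ α i _ y) (r-comp ∩⊆Φ proj₂ p x) (proj₂ (α-II i ∩⊆Φ x proj₁) a∈))
    where
      ∩⊆Φ : α i Φ x ∩ _ ⊆ Φ
      ∩⊆Φ = α-O i Φ x ∘ proj₁

  ⊆α-r-⇔ : ∀ i {Θ Φ Ψ : Sub} (p : Ψ ⊆ Φ) x → Θ ⊆ Ψ → Θ ⊆ α i Φ x ⇔ Θ ⊆ α i Ψ (r p x)
  ⊆α-r-⇔ i {Θ} {Φ} {Ψ} p x Θ⊆Ψ = mk⇔ {A = Θ ⊆ α i Φ x} {B = Θ ⊆ α i Ψ (r p x)}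
    (λ Θ⊆α a∈Θ → α∩⊆α-r i p x (Θ⊆α a∈Θ , Θ⊆Ψ a∈Θ))
    (λ Θ⊆α a∈Θ → α-IV i p x (Θ⊆α a∈Θ))

  ⊨⇒atoms⊆ : ∀ φ Φ x → (Φ , x) ⊨ φ → atoms φ ⊆ Φ
  ⊨⇒atoms⊆ ⊤ᶠ Φ x _ ()
  ⊨⇒atoms⊆ (atom q) Φ x (q⊆Φ , _) = q⊆Φ
  ⊨⇒atoms⊆ (¬ᶠ φ) Φ x (φ⊆Φ , _) = φ⊆Φ
  ⊨⇒atoms⊆ (φ ∧ᶠ ψ) Φ x (⊨φ , ⊨ψ) (inj₁ a∈φ) = ⊨⇒atoms⊆ φ Φ x ⊨φ a∈φ
  ⊨⇒atoms⊆ (φ ∧ᶠ ψ) Φ x (⊨φ , ⊨ψ) (inj₂ a∈ψ) = ⊨⇒atoms⊆ ψ Φ x ⊨ψ a∈ψ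
  ⊨⇒atoms⊆ (ℓᶠ i φ) Φ x ℓφ = ⊨⇒atoms⊆ φ Φ x (ℓφ x (Λ-refl i Φ x))
  ⊨⇒atoms⊆ (aᶠ i φ) Φ x φ⊆α = α-O i Φ x ∘ φ⊆α
  ⊨⇒atoms⊆ (kᶠ i φ) Φ x kφ = α-O i Φ x ∘ ⊨⇒atoms⊆ φ _ _ (kφ x (Λ-refl i Φ x))

  ProjectionInvariant : Form → Set₁
  ProjectionInvariant φ =
    ∀ {Φ Ψ} (p : Ψ ⊆ Φ) x → atoms φ ⊆ Ψ → (Φ , x) ⊨ φ ⇔ (Ψ , r p x) ⊨ φ

  ℓ-projectionInvariant : ∀ i {φ} → ProjectionInvariant φ → ProjectionInvariant (ℓᶠ i φ)
  ℓ-projectionInvariant i inv p x φ⊆Ψ = mk⇔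
    (λ ℓφ z z∈Λ → case proj₂ (Λ-proj i p x) {z} z∈Λ of λ where
      (y , y∈Λ , refl) → to (inv p y φ⊆Ψ) (ℓφ y y∈Λ))
    (λ ℓφ y y∈Λ → from (inv p y φ⊆Ψ) (ℓφ (r p y) (proj₁ (Λ-proj i p x) (y , y∈Λ , refl))))

  ⊨k⇔⊨ℓ×⊨a : ∀ i {φ} → ProjectionInvariant φ → ∀ Φ x →
             (Φ , x) ⊨ kᶠ i φ ⇔ ((Φ , x) ⊨ ℓᶠ i φ × (Φ , x) ⊨ aᶠ i φ)
  ⊨k⇔⊨ℓ×⊨a i {φ} inv Φ x = mk⇔ {B = (Φ , x) ⊨ ℓᶠ i φ × (Φ , x) ⊨ aᶠ i φ}
    (λ kφ → (λ y y∈Λ → from (inv (α-O i Φ x) y (aware kφ)) (kφ y y∈Λ)) , aware kφ)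
    (λ (ℓφ , φ⊆α) y y∈Λ → to (inv (α-O i Φ x) y φ⊆α) (ℓφ y y∈Λ))
    where
      aware : (Φ , x) ⊨ kᶠ i φ → atoms φ ⊆ α i Φ x
      aware kφ = ⊨⇒atoms⊆ φ _ _ (kφ x (Λ-refl i Φ x))

  k-projectionInvariant : ∀ i {φ} → ProjectionInvariant φ → ProjectionInvariant (kᶠ i φ)
  k-projectionInvariant i inv {Φ} {Ψ} p x φ⊆Ψ =
    ⇔-sym (⊨k⇔⊨ℓ×⊨a i inv Ψ (r p x))
      ⇔-∘ ((ℓ-projectionInvariant i inv p x φ⊆Ψ ×-⇔ ⊆α-r-⇔ i p x φ⊆Ψ)
      ⇔-∘ ⊨k⇔⊨ℓ×⊨a i inv Φ x)

  projectionInvariant : ∀ φ → ProjectionInvariant φ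
  projectionInvariant ⊤ᶠ p x _ = ⇔-id _
  projectionInvariant (atom q) p x q⊆Ψ = ↑-r-⇔ (v q) p x q⊆Ψ
  projectionInvariant (¬ᶠ φ) p x φ⊆Ψ = ↑-r-⇔ (∁ λ y → (atoms φ , y) ⊨ φ) p x φ⊆Ψ
  projectionInvariant (φ ∧ᶠ ψ) p x φψ⊆Ψ =
    projectionInvariant φ p x (φψ⊆Ψ ∘ inj₁) ×-⇔ projectionInvariant ψ p x (φψ⊆Ψ ∘ inj₂)
  projectionInvariant (ℓᶠ i φ) = ℓ-projectionInvariant i (projectionInvariant φ)
  projectionInvariant (aᶠ i φ) p x = ⊆α-r-⇔ i p x
  projectionInvariant (kᶠ i φ) = k-projectionInvariant i (projectionInvariant φ)

  ⊨¬⇔¬⊨ : ∀ φ Φ x → atoms φ ⊆ Φ → (Φ , x) ⊨ ¬ᶠ φ ⇔ (¬ (Φ , x) ⊨ φ)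
  ⊨¬⇔¬⊨ φ Φ x φ⊆Φ = mk⇔ {A = (Φ , x) ⊨ ¬ᶠ φ}
    (λ (φ⊆Φ′ , ¬φ) → ¬φ ∘ to (projectionInvariant φ {Φ} φ⊆Φ′ x (λ a∈φ → a∈φ)))
    (λ ¬φ → φ⊆Φ , ¬φ ∘ from (projectionInvariant φ {Φ} φ⊆Φ x (λ a∈φ → a∈φ)))

  open FHSem (FH* Lat M)

  ⊨ℓ⇔⊩ℓ : ∀ i φ → (∀ y → (U , y) ⊨ φ ⇔ y ⊩ φ) → ∀ ω → (U , ω) ⊨ ℓᶠ i φ ⇔ ω ⊩ ℓᶠ i φ
  ⊨ℓ⇔⊩ℓ i φ ⊨⇔⊩φ ω = mk⇔
    (λ ℓφ y y∈Λ → to (⊨⇔⊩φ y) (ℓφ y y∈Λ))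
    (λ ℓφ y y∈Λ → from (⊨⇔⊩φ y) (ℓφ y y∈Λ))

  ⊨⇔⊩ : ∀ φ (ω : S U) → (U , ω) ⊨ φ ⇔ ω ⊩ φ
  ⊨⇔⊩ ⊤ᶠ ω = ⇔-id _
  ⊨⇔⊩ (atom q) ω = ⇔-id _
  ⊨⇔⊩ (¬ᶠ φ) ω = ¬-cong-⇔ (⊨⇔⊩ φ ω) ⇔-∘ ⊨¬⇔¬⊨ φ U ω (λ _ → tt)
  ⊨⇔⊩ (φ ∧ᶠ ψ) ω = ⊨⇔⊩ φ ω ×-⇔ ⊨⇔⊩ ψ ω
  ⊨⇔⊩ (ℓᶠ i φ) = ⊨ℓ⇔⊩ℓ i φ (⊨⇔⊩ φ)
  ⊨⇔⊩ (aᶠ i φ) ω = ⇔-id _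
  ⊨⇔⊩ (kᶠ i φ) ω =
    (⊨ℓ⇔⊩ℓ i φ (⊨⇔⊩ φ) ω ×-⇔ ⇔-id _) ⇔-∘ ⊨k⇔⊨ℓ×⊨a i (projectionInvariant φ) U ω

proposition13 : (At I : Set) → At → I →
    (Lat : Logic.Lattice At I) (M : Logic.HMSDef.HMS At I Lat) →
    (φ : Logic.Form At I) → Logic.L At I U φ → (ω : Logic.Lattice.S Lat U) →
    Logic.HMSDef.HMS._⊨_ M (U , ω) φ ⇔ Logic.FHSem._⊩_ At I (Logic.FH* At I Lat M) ω φ
proposition13 At I _ _ Lat M φ _ ω = ProjectionInvariance.⊨⇔⊩ At I Lat M φ ω
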